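{- Let $q$ be a prime power with $q=ef+1=\epsilon\rho+1$, where $e,f,\epsilon,\rho>1$ are integers and $\epsilon\mid e$. (a) Let $q\equiv1\pmod{2\epsilon}$. (i) If $C_0^\epsilon$ is a partial difference set in $(GF(q),+)$, then it is proper (i.e. $C_0^\epsilon$ is not a difference set). (ii) Let $f$ be even. If ${C_0^\epsilon}'$ is a disjoint partial difference family, then it is proper. Now let $\epsilon>2$. (iii) If $C_0^\epsilon$ is a (proper) partial difference set, then $-2,2\in C_0^\epsilon$. (iv) Let $f$ be even. If ${C_0^\epsilon}'$ is a (proper) disjoint partial difference family, then $-2,2\in C_0^\epsilon$. (b) Let $q\equiv\epsilon+1\pmod{2\epsilon}$ and suppose $\epsilon$ is even. (i) $C_0^\epsilon$ cannot be a proper partial difference set. (ii) If $\epsilon<e$, then ${C_0^\epsilon}'$ cannot be a proper disjoint partial difference family.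
   Context: Let $\alpha$ be a primitive element of $GF(q)$; for a divisor $d$ of $q-1$, $C_i^d=\alpha^i\langle\alpha^d\rangle$ ($0\le i\le d-1$) are the cyclotomic classes of order $d$. ${C_0^\epsilon}'$ denotes the family $\{C_0^e,C_\epsilon^e,C_{2\epsilon}^e,\ldots,C_{e-\epsilon}^e\}$, which partitions $C_0^\epsilon$. All difference notions are in the additive group $G=(GF(q),+)$, $G^*=G\setminus\{0\}$: $\Delta(D)$ is the multiset $\{x-y:x,y\in D, x\neq y\}$; $D$ is a partial difference set if $\Delta(D)=\lambda D+\mu(G^*\setminus D)$ for some $\lambda,\mu$ (proper if $\lambda\neq\mu$; a difference set if $\lambda=\mu$). A family $\{D_1,\dots,D_m\}$ of disjoint equal-size subsets of $G^*$ with union $S$ is a disjoint partial difference family if $\bigcup_i\Delta(D_i)=\lambda S+\mu(G^*\setminus S)$ for some $\lambda,\mu$, proper if $\lambda\neq\mu$. -}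

module Defs where

open import Level using (0ℓ)
open import Data.Nat using (ℕ; zero; suc) renaming (_+_ to _+ℕ_; _*_ to _*ℕ_)
open import Data.Nat.ListAction using (sum)
open import Data.Product using (Σ; ∃; _×_; _,_; proj₁; proj₂)
open import Data.List using (List; []; _∷_; map; length; upTo; concat; cartesianProduct; filter)
open import Data.List.Membership.Propositional using (_∈_; _∉_)
open import Data.List.Relation.Unary.All using (All)
open import Data.List.Relation.Unary.AllPairs using (AllPairs)
open import Data.List.Relation.Unary.Unique.Propositional using (Unique)
open import Relation.Binary.PropositionalEquality using (_≡_; _≢_)
open import Relation.Binary.Definitions using (DecidableEquality)
open import Relation.Nullary.Decidable using (_×-dec_; ¬?)
open import Algebra.Structures using (IsCommutativeRing)

-- Its order is |F| = length elements.
-- (Up to isomorphism this is GF(q), q = |F|; q is then automatically a prime power.)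
record FiniteField : Set₁ where
  field
    Carrier  : Set
    _+_ _*_  : Carrier → Carrier → Carrier
    -_       : Carrier → Carrier
    0# 1#    : Carrier
    isCommutativeRing : IsCommutativeRing _≡_ _+_ _*_ -_ 0# 1#
    _≟_      : DecidableEquality Carrier
    0≢1      : 0# ≢ 1#
    inverse  : ∀ x → x ≢ 0# → Σ Carrier (λ y → x * y ≡ 1#)
    elements : List Carrier
    complete : ∀ x → x ∈ elements
    unique   : Unique elements

  infixl 6 _+_ _-_
  infixl 7 _*_

  _-_ : Carrier → Carrier → Carrier
  x - y = x + (- y)

  order : ℕ
  order = length elements

  _^_ : Carrier → ℕ → Carrier
  x ^ zero  = 1#
  x ^ suc n = x * (x ^ n)

  two : Carrier
  two = 1# + 1#

  minusTwo : Carrier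
  minusTwo = - two

  Primitive : Carrier → Set
  Primitive α = α ≢ 0# × (∀ x → x ≢ 0# → ∃ λ k → α ^ k ≡ x)

  -- Cyclotomic class C_i^d = α^i ⟨α^d⟩, given as the (duplicate-free) list
  -- [ α^(i + d k) | k < m ] where m = (q-1)/d is the size of ⟨α^d⟩
  -- (the caller passes m with d * m = q - 1).
  cyc : Carrier → (d m i : ℕ) → List Carrier
  cyc α d m i = map (λ k → α ^ (i +ℕ d *ℕ k)) (upTo m)

  -- Multiplicity of g in the multiset Δ(D) = {x - y : x,y ∈ D, x ≠ y}.
  diffCount : List Carrier → Carrier → ℕ
  diffCount D g =
    length (filter (λ p → ¬? (proj₁ p ≟ proj₂ p) ×-dec ((proj₁ p - proj₂ p) ≟ g))
                   (cartesianProduct D D))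

  IsSubsetOfG* : List Carrier → Set
  IsSubsetOfG* D = All (_≢ 0#) D × Unique D

  -- D is a partial difference set with parameters λ, μ:
  -- Δ(D) = λ D + μ (G* \ D).
  IsPDSWith : List Carrier → ℕ → ℕ → Set
  IsPDSWith D λ′ μ =
    IsSubsetOfG* D ×
    (∀ g → g ≢ 0# → (g ∈ D → diffCount D g ≡ λ′) × (g ∉ D → diffCount D g ≡ μ))

  -- {D_1,...,D_m} is a disjoint partial difference family with parameters λ, μ:
  -- disjoint equal-size subsets of G* with union S, and
  -- ⋃ Δ(D_i) = λ S + μ (G* \ S).
  IsDPDFWith : List (List Carrier) → ℕ → ℕ → Set
  IsDPDFWith Ds λ′ μ =
    All IsSubsetOfG* Ds ×
    AllPairs (λ A B → ∀ x → x ∈ A → x ∉ B) Ds ×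
    AllPairs (λ A B → length A ≡ length B) Ds ×
    (∀ g → g ≢ 0# →
       (g ∈ concat Ds → sum (map (λ D → diffCount D g) Ds) ≡ λ′) ×
       (g ∉ concat Ds → sum (map (λ D → diffCount D g) Ds) ≡ μ))

open import Data.Nat.Divisibility using (_∣_)

Even : ℕ → Set
Even n = ∃ λ k → n ≡ 2 *ℕ k

-- The family (C_0^ε)′ = {C_0^e, C_ε^e, C_{2ε}^e, …, C_{e-ε}^e}, indices jε for j < e/ε,
-- each class of size f = (q-1)/e.
familyC0′ : (F : FiniteField) → FiniteField.Carrier F → (e f ε : ℕ) → ε ∣ e →
            List (List (FiniteField.Carrier F))
familyC0′ F α e f ε ε∣e =
  map (λ j → FiniteField.cyc F α e f (j *ℕ ε)) (upTo (_∣_.quotient ε∣e))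

-- Write N = q - 1 and S = C_0^ε = {α ^ (ε k)}.  If q ≡ 1 (mod 2ε) then - 1 = α ^ (N / 2) lies in S,
-- and in every C_i^e when f is even.  For a negation-closed set D the map (x , y) ↦ (- y , - x)
-- is an involution on the pairs of D with difference h + h whose only possible fixed point is
-- (h , - h), so that count is odd exactly when h ∈ D.  Hence 2 = 1 + 1 is represented an odd
-- number of times and α + α (α ∉ S) an even number of times, so λ ≠ μ.  If moreover 2 ∉ S, some
-- h ∈ {α , α²} has h , h + h ∉ S, and comparing the counts at 2 and at h + h makes μ both odd
-- and even.  If q ≡ ε + 1 (mod 2ε) with ε even, then - 1 ∉ S while g and - g are always
-- represented equally often, so λ = Δ(1) = Δ(- 1) = μ.

module Submission where

open import Defs
open import Level using (0ℓ)
open import Function using (_∘_; id)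
open import Data.Empty using (⊥-elim)
open import Data.Nat using (ℕ; zero; suc; _+_; _*_; _∸_; _≤_; _<_; z≤n; s≤s; NonZero; >-nonZero)
open import Data.Nat.Properties hiding (_≟_)
open import Data.Nat.DivMod using (_%_; _/_; m≡m%n+[m/n]*n; m%n<n)
open import Data.Nat.Divisibility using (_∣_; divides; ∣m∣n⇒∣m+n; ∣m+n∣m⇒∣n; ∣-trans; n∣m*n; m∣m*n; ∣1⇒≡1; ∣⇒≤; *-cancelˡ-∣)
open import Data.Nat.ListAction using (sum)
open import Data.Nat.Tactic.RingSolver using (solve-∀)
open import Data.Product using (∃; _×_; _,_; proj₁; proj₂; swap; uncurry)
open import Data.Product.Properties using (≡-dec)
open import Data.Sum using (inj₁; inj₂)
open import Data.List using (List; []; _∷_; length; filter; map; upTo; applyUpTo; concat; cartesianProduct)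
open import Data.List.Properties using (length-map; length-upTo; length-applyUpTo; filter-notAll; filter-reject; filter-accept; filter-all; filter-none)
open import Data.List.Membership.Propositional using (_∈_; _∉_)
open import Data.List.Membership.Propositional.Properties
open import Data.List.Relation.Binary.Subset.Propositional using (_⊆_)
open import Data.List.Relation.Unary.Any using (here; there)
import Data.List.Relation.Unary.Any as Any
open import Data.List.Relation.Unary.All using (All; []; _∷_)
import Data.List.Relation.Unary.All as All
open import Data.List.Relation.Unary.AllPairs using (AllPairs; []; _∷_)
open import Data.List.Relation.Unary.Unique.Propositional using (Unique)
import Data.List.Relation.Unary.Unique.Propositional.Properties as Unique
import Data.List.Membership.DecPropositional as DecMembership
open import Relation.Binary.PropositionalEquality
open import Relation.Binary.Definitions using (DecidableEquality; tri<; tri≈; tri>)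
open import Relation.Nullary using (¬_; yes; no)
open import Relation.Nullary.Decidable using (¬?; _×-dec_)
open import Relation.Unary using (Pred; Decidable)
open import Algebra.Structures using (IsCommutativeRing)
open import Algebra.Bundles using (Ring)
import Algebra.Properties.Ring as RingProperties

Odd : ℕ → Set
Odd n = ∃ λ k → n ≡ 1 + 2 * k

odd⇒¬even : ∀ {n} → Odd n → ¬ Even n
odd⇒¬even (a , refl) (b , eq) = 1+2a≢2b a b eq
  where
  1+2a≢2b : ∀ a b → 1 + 2 * a ≢ 2 * b
  1+2a≢2b a       zero    ()
  1+2a≢2b zero    (suc b) eq with trans eq (*-suc 2 b)
  ... | ()
  1+2a≢2b (suc a) (suc b) eq = 1+2a≢2b a b
    (suc-injective (suc-injective (trans (cong suc (sym (*-suc 2 a))) (trans eq (*-suc 2 b)))))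

2∣⇒even : ∀ {n} → 2 ∣ n → Even n
2∣⇒even (divides r refl) = r , *-comm r 2

even+even : ∀ {m n} → Even m → Even n → Even (m + n)
even+even (a , refl) (b , refl) = a + b , sym (*-distribˡ-+ 2 a b)

odd+even : ∀ {m n} → Odd m → Even n → Odd (m + n)
odd+even (a , refl) (b , refl) = a + b , cong suc (sym (*-distribˡ-+ 2 a b))

+-2*suc : ∀ m n → m + 2 * suc n ≡ suc (suc (m + 2 * n))
+-2*suc m n = trans (cong (m +_) (*-suc 2 n)) (trans (+-suc m _) (cong suc (+-suc m _)))

even+odd : ∀ {m n} → Even m → Odd n → Odd (m + n)
even+odd {m} {n} even odd = subst Odd (+-comm n m) (odd+even odd even)

module _ {A : Set} (_≟_ : DecidableEquality A) where

  without : A → List A → List A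
  without x = filter (λ y → ¬? (y ≟ x))

  ∈-without⁺ : ∀ {x y xs} → y ∈ xs → y ≢ x → y ∈ without x xs
  ∈-without⁺ {x} = ∈-filter⁺ (λ y → ¬? (y ≟ x))

  ∈-without⁻ : ∀ {x y xs} → y ∈ without x xs → y ∈ xs × y ≢ x
  ∈-without⁻ {x} {xs = xs} = ∈-filter⁻ (λ y → ¬? (y ≟ x)) {xs = xs}

  length-without : ∀ {x xs} → Unique xs → x ∈ xs → length xs ≡ suc (length (without x xs))
  length-without {x} {x ∷ xs} (x∉xs ∷ _) (here refl) = cong suc (sym (cong length (begin
    without x (x ∷ xs) ≡⟨ filter-reject (λ y → ¬? (y ≟ x)) (λ x≢x → x≢x refl) ⟩
    without x xs       ≡⟨ filter-all (λ y → ¬? (y ≟ x)) (All.map (λ x≢y y≡x → x≢y (sym y≡x)) x∉xs) ⟩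
    xs                 ∎)))
    where open ≡-Reasoning
  length-without {x} {y ∷ xs} (y∉xs ∷ u) (there x∈xs) = cong suc (trans (length-without u x∈xs)
    (cong length (sym (filter-accept (λ z → ¬? (z ≟ x)) (All.lookup y∉xs x∈xs)))))

  ⊆⇒length≤ : ∀ {xs ys} → Unique xs → xs ⊆ ys → length xs ≤ length ys
  ⊆⇒length≤ {[]}     _            _     = z≤n
  ⊆⇒length≤ {x ∷ xs} {ys} (x∉xs ∷ u) xs⊆ys =
    ≤-trans (s≤s (⊆⇒length≤ u xs⊆ys∖x))
            (filter-notAll (λ y → ¬? (y ≟ x)) ys (Any.map (λ x≡y y≢x → y≢x (sym x≡y)) (xs⊆ys (here refl))))
    where
    xs⊆ys∖x : xs ⊆ without x ys
    xs⊆ys∖x y∈xs = ∈-without⁺ (xs⊆ys (there y∈xs)) (λ y≡x → All.lookup x∉xs y∈xs (sym y≡x))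

  module _ {P : Pred A 0ℓ} (P? : Decidable P) where

    filter-∷-cong : ∀ y {xs ys} → filter P? xs ≡ filter P? ys → filter P? (y ∷ xs) ≡ filter P? (y ∷ ys)
    filter-∷-cong y eq with P? y
    ... | yes _ = cong (y ∷_) eq
    ... | no  _ = eq

    filter-without : ∀ {c} → ¬ P c → ∀ xs → filter P? (without c xs) ≡ filter P? xs
    filter-without ¬Pc [] = refl
    filter-without {c} ¬Pc (y ∷ xs) with y ≟ c
    ... | yes refl = trans (filter-without ¬Pc xs) (sym (filter-reject P? ¬Pc))
    ... | no  _    = filter-∷-cong y (filter-without ¬Pc xs)

    length-filter≡1 : ∀ {xs c} → Unique xs → c ∈ xs → P c → (∀ {x} → x ∈ xs → P x → x ≡ c) →
                      length (filter P? xs) ≡ 1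
    length-filter≡1 {c ∷ xs} (c∉xs ∷ _) (here refl) Pc only-c = trans
      (cong length (filter-accept P? Pc))
      (cong (suc ∘ length) (filter-none P? (All.tabulate λ x∈xs Px →
        All.lookup c∉xs x∈xs (sym (only-c (there x∈xs) Px)))))
    length-filter≡1 {y ∷ xs} (y∉xs ∷ u) (there c∈xs) Pc only-c = trans
      (cong length (filter-reject P? λ Py → All.lookup y∉xs c∈xs (only-c (here refl) Py)))
      (length-filter≡1 u c∈xs Pc (only-c ∘ there))

  module _ (σ : A → A) (σ-involutive : ∀ x → σ (σ x) ≡ x) where

    Fixed? : Decidable (λ x → σ x ≡ x)
    Fixed? x = σ x ≟ x

    -- The elements not fixed by σ come in pairs {x , σ x}.
    length≡fixed+even : ∀ {xs} → Unique xs → (∀ {x} → x ∈ xs → σ x ∈ xs) →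
                        ∃ λ k → length xs ≡ length (filter Fixed? xs) + 2 * k
    length≡fixed+even {xs} = go (length xs) xs ≤-refl
      where
      go : ∀ n xs → length xs ≤ n → Unique xs → (∀ {x} → x ∈ xs → σ x ∈ xs) →
           ∃ λ k → length xs ≡ length (filter Fixed? xs) + 2 * k
      go _       []       _           _            _      = 0 , refl
      go (suc n) (x ∷ xs) (s≤s len≤n) (x∉xs ∷ u) closed with σ x ≟ x
      ... | yes σx≡x = let k , eq = go n xs len≤n u closed-xs in k , cong suc eq
        where
        closed-xs : ∀ {y} → y ∈ xs → σ y ∈ xs
        closed-xs {y} y∈xs with closed (there y∈xs)
        ... | there σy∈xs = σy∈xs
        ... | here σy≡x   = ⊥-elim (All.lookup x∉xs y∈xs
                              (trans (sym σx≡x) (trans (cong σ (sym σy≡x)) (σ-involutive y))))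
      ... | no σx≢x = let k , eq = go n ys len-ys≤n (Unique.filter⁺ _ u) closed-ys in suc k , (begin
          suc (length xs)                              ≡⟨ cong suc length-xs ⟩
          suc (suc (length ys))                        ≡⟨ cong (suc ∘ suc) eq ⟩
          suc (suc (length (filter Fixed? ys) + 2 * k)) ≡⟨ cong (λ a → suc (suc (a + 2 * k))) fixed-ys ⟩
          suc (suc (length (filter Fixed? xs) + 2 * k)) ≡⟨ sym (+-2*suc (length (filter Fixed? xs)) k) ⟩
          length (filter Fixed? xs) + 2 * suc k        ∎)
        where
        open ≡-Reasoning
        σx∈xs : σ x ∈ xs
        σx∈xs with closed (here refl)
        ... | here σx≡x   = ⊥-elim (σx≢x σx≡x)
        ... | there σx∈xs = σx∈xs
        ys : List A
        ys = without (σ x) xs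
        length-xs : length xs ≡ suc (length ys)
        length-xs = length-without u σx∈xs
        len-ys≤n : length ys ≤ n
        len-ys≤n = ≤-trans (n≤1+n _) (subst (_≤ n) length-xs len≤n)
        fixed-ys : length (filter Fixed? ys) ≡ length (filter Fixed? xs)
        fixed-ys = cong length
          (filter-without Fixed? (λ σσx≡σx → σx≢x (trans (sym σσx≡σx) (σ-involutive x))) xs)
        closed-ys : ∀ {y} → y ∈ ys → σ y ∈ ys
        closed-ys {y} y∈ys with ∈-without⁻ y∈ys
        ... | y∈xs , y≢σx with closed (there y∈xs)
        ... | here σy≡x   = ⊥-elim (y≢σx (trans (sym (σ-involutive y)) (cong σ σy≡x)))
        ... | there σy∈xs = ∈-without⁺ σy∈xs λ σy≡σx →
              All.lookup x∉xs y∈xs (sym (trans (sym (σ-involutive y)) (trans (cong σ σy≡σx) (σ-involutive x))))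

module FieldProperties (F : FiniteField) where

  open FiniteField F renaming (_+_ to infixl 6 _⊕_; _*_ to infixl 7 _⊗_)
  module R = IsCommutativeRing isCommutativeRing
  open ≡-Reasoning

  ring : Ring 0ℓ 0ℓ
  ring = record { Carrier = Carrier ; _≈_ = _≡_ ; _+_ = _⊕_ ; _*_ = _⊗_ ; -_ = -_ ; 0# = 0# ; 1# = 1#
                ; isRing = R.isRing }
  module RP = RingProperties ring

  1≢0 : 1# ≢ 0#
  1≢0 = 0≢1 ∘ sym

  -1≢0 : - 1# ≢ 0#
  -1≢0 -1≡0 = 1≢0 (trans (sym (RP.-‿involutive 1#)) (trans (cong -_ -1≡0) RP.-0#≈0#))

  *-cancelˡ : ∀ {x a b} → x ≢ 0# → x ⊗ a ≡ x ⊗ b → a ≡ b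
  *-cancelˡ {x} {a} {b} x≢0 xa≡xb with inverse x x≢0
  ... | y , xy≡1 = begin
    a             ≡⟨ sym (y[xz]≡z a) ⟩
    y ⊗ (x ⊗ a)   ≡⟨ cong (y ⊗_) xa≡xb ⟩
    y ⊗ (x ⊗ b)   ≡⟨ y[xz]≡z b ⟩
    b             ∎
    where
    y[xz]≡z : ∀ z → y ⊗ (x ⊗ z) ≡ z
    y[xz]≡z z = begin
      y ⊗ (x ⊗ z) ≡⟨ sym (R.*-assoc y x z) ⟩
      y ⊗ x ⊗ z   ≡⟨ cong (_⊗ z) (trans (R.*-comm y x) xy≡1) ⟩
      1# ⊗ z      ≡⟨ R.*-identityˡ z ⟩
      z           ∎

  ^-+ : ∀ x m n → x ^ (m + n) ≡ x ^ m ⊗ x ^ n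
  ^-+ x zero    n = sym (R.*-identityˡ _)
  ^-+ x (suc m) n = trans (cong (x ⊗_) (^-+ x m n)) (sym (R.*-assoc x _ _))

  ^-* : ∀ x m n → x ^ (m * n) ≡ (x ^ n) ^ m
  ^-* x zero    n = refl
  ^-* x (suc m) n = trans (^-+ x n (m * n)) (cong (x ^ n ⊗_) (^-* x m n))

  1^ : ∀ n → 1# ^ n ≡ 1#
  1^ zero    = refl
  1^ (suc n) = trans (R.*-identityˡ _) (1^ n)

  ^-periodic : ∀ {x n} → x ^ n ≡ 1# → ∀ r q → x ^ (r + q * n) ≡ x ^ r
  ^-periodic {x} {n} xⁿ≡1 r q = begin
    x ^ (r + q * n)     ≡⟨ ^-+ x r (q * n) ⟩
    x ^ r ⊗ x ^ (q * n) ≡⟨ cong (x ^ r ⊗_) (trans (^-* x q n) (trans (cong (_^ q) xⁿ≡1) (1^ q))) ⟩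
    x ^ r ⊗ 1#          ≡⟨ R.*-identityʳ _ ⟩
    x ^ r               ∎

  ^-mod : ∀ {x n} .{{_ : NonZero n}} → x ^ n ≡ 1# → ∀ k → x ^ k ≡ x ^ (k % n)
  ^-mod {x} {n} xⁿ≡1 k = trans (cong (x ^_) (m≡m%n+[m/n]*n k n)) (^-periodic xⁿ≡1 (k % n) (k / n))

  ^≢0 : ∀ {x} → x ≢ 0# → ∀ n → x ^ n ≢ 0#
  ^≢0 x≢0 zero    = 1≢0
  ^≢0 x≢0 (suc n) xⁿ⁺¹≡0 = ^≢0 x≢0 n (*-cancelˡ x≢0 (trans xⁿ⁺¹≡0 (sym (R.zeroʳ _))))

  ^-cancel : ∀ {x i j} → x ≢ 0# → i ≤ j → x ^ i ≡ x ^ j → x ^ (j ∸ i) ≡ 1#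
  ^-cancel {x} {i} {j} x≢0 i≤j xⁱ≡xʲ = sym (*-cancelˡ (^≢0 x≢0 i) (begin
    x ^ i ⊗ 1#          ≡⟨ R.*-identityʳ _ ⟩
    x ^ i               ≡⟨ xⁱ≡xʲ ⟩
    x ^ j               ≡⟨ cong (x ^_) (sym (m+[n∸m]≡n i≤j)) ⟩
    x ^ (i + (j ∸ i))   ≡⟨ ^-+ x i (j ∸ i) ⟩
    x ^ i ⊗ x ^ (j ∸ i) ∎))

  x²≡1⇒x≡-1 : ∀ {x} → x ⊗ x ≡ 1# → x ≢ 1# → x ≡ - 1#
  x²≡1⇒x≡-1 {x} x²≡1 x≢1 with (x ⊕ 1#) ≟ 0#
  ... | yes x+1≡0 = begin
    x                ≡⟨ sym (R.+-identityʳ x) ⟩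
    x ⊕ 0#           ≡⟨ cong (x ⊕_) (sym (R.-‿inverseʳ 1#)) ⟩
    x ⊕ (1# ⊕ - 1#)  ≡⟨ sym (R.+-assoc x 1# (- 1#)) ⟩
    x ⊕ 1# ⊕ - 1#    ≡⟨ cong (_⊕ - 1#) x+1≡0 ⟩
    0# ⊕ - 1#        ≡⟨ R.+-identityˡ _ ⟩
    - 1#             ∎
  ... | no x+1≢0 = ⊥-elim (x≢1 (*-cancelˡ x+1≢0 (begin
    (x ⊕ 1#) ⊗ x     ≡⟨ R.distribʳ x x 1# ⟩
    x ⊗ x ⊕ 1# ⊗ x   ≡⟨ cong₂ _⊕_ x²≡1 (R.*-identityˡ x) ⟩
    1# ⊕ x           ≡⟨ R.+-comm 1# x ⟩
    x ⊕ 1#           ≡⟨ sym (R.*-identityʳ _) ⟩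
    (x ⊕ 1#) ⊗ 1#    ∎)))

  -1≢1⇒two≢0 : - 1# ≢ 1# → two ≢ 0#
  -1≢1⇒two≢0 -1≢1 two≡0 = -1≢1 (begin
    - 1#               ≡⟨ sym (R.+-identityʳ _) ⟩
    - 1# ⊕ 0#          ≡⟨ cong (- 1# ⊕_) (sym two≡0) ⟩
    - 1# ⊕ (1# ⊕ 1#)   ≡⟨ sym (R.+-assoc _ _ _) ⟩
    - 1# ⊕ 1# ⊕ 1#     ≡⟨ cong (_⊕ 1#) (R.-‿inverseˡ 1#) ⟩
    0# ⊕ 1#            ≡⟨ R.+-identityˡ _ ⟩
    1#                 ∎)

  x+x≡two*x : ∀ x → x ⊕ x ≡ two ⊗ x
  x+x≡two*x x = sym (trans (R.distribʳ x 1# 1#) (cong₂ _⊕_ (R.*-identityˡ x) (R.*-identityˡ x)))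

  x+x-injective : two ≢ 0# → ∀ {x y} → x ⊕ x ≡ y ⊕ y → x ≡ y
  x+x-injective two≢0 {x} {y} eq = *-cancelˡ two≢0 (trans (sym (x+x≡two*x x)) (trans eq (x+x≡two*x y)))

  x+x≢0 : two ≢ 0# → ∀ {x} → x ≢ 0# → x ⊕ x ≢ 0#
  x+x≢0 two≢0 x≢0 x+x≡0 = x≢0 (x+x-injective two≢0 (trans x+x≡0 (sym (R.+-identityʳ 0#))))

module DifferenceCounts (F : FiniteField) where

  open FiniteField F renaming (_+_ to infixl 6 _⊕_; _*_ to infixl 7 _⊗_)
  open FieldProperties F
  open DecMembership _≟_ using (_∈?_)

  private variable
    x y g h : Carrier
    D T     : List Carrier
    Ds      : List (List Carrier)
    v       : Carrier → ℕ
    λ′ μ    : ℕ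

  -- IsPDSWith D λ′ μ unfolds to IsSubsetOfG* D × DiffProfile (diffCount D) D λ′ μ,
  -- and IsDPDFWith Ds λ′ μ ends with DiffProfile (familyDiffCount Ds) (concat Ds) λ′ μ.
  DiffProfile : (Carrier → ℕ) → List Carrier → ℕ → ℕ → Set
  DiffProfile v T λ′ μ = ∀ g → g ≢ 0# → (g ∈ T → v g ≡ λ′) × (g ∉ T → v g ≡ μ)

  profile-constant : DiffProfile v T λ′ λ′ → g ≢ 0# → v g ≡ λ′
  profile-constant {T = T} {g = g} profile g≢0 with g ∈? T
  ... | yes g∈T = proj₁ (profile g g≢0) g∈T
  ... | no  g∉T = proj₂ (profile g g≢0) g∉T

  odd-even⇒proper : DiffProfile v T λ′ μ → x ≢ 0# → y ≢ 0# → Odd (v x) → Even (v y) → λ′ ≢ μ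
  odd-even⇒proper profile x≢0 y≢0 odd even refl =
    odd⇒¬even (subst Odd (profile-constant profile x≢0) odd) (subst Even (profile-constant profile y≢0) even)

  odd-even-outside⇒⊥ : DiffProfile v T λ′ μ → x ≢ 0# → y ≢ 0# → x ∉ T → y ∉ T →
                       Odd (v x) → ¬ Even (v y)
  odd-even-outside⇒⊥ {x = x} {y = y} profile x≢0 y≢0 x∉T y∉T odd even =
    odd⇒¬even (subst Odd (proj₂ (profile x x≢0) x∉T) odd) (subst Even (proj₂ (profile y y≢0) y∉T) even)

  inside-outside⇒improper : DiffProfile v T λ′ μ → x ≢ 0# → y ≢ 0# → x ∈ T → y ∉ T →
                            v x ≡ v y → λ′ ≡ μ
  inside-outside⇒improper {x = x} {y = y} profile x≢0 y≢0 x∈T y∉T vx≡vy =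
    trans (sym (proj₁ (profile x x≢0) x∈T)) (trans vx≡vy (proj₂ (profile y y≢0) y∉T))

  differencePairs : List Carrier → Carrier → List (Carrier × Carrier)
  differencePairs D g =
    filter (λ p → ¬? (proj₁ p ≟ proj₂ p) ×-dec ((proj₁ p - proj₂ p) ≟ g)) (cartesianProduct D D)

  ∈-differencePairs⁻ : (x , y) ∈ differencePairs D g → x ∈ D × y ∈ D × x ≢ y × x - y ≡ g
  ∈-differencePairs⁻ {D = D} {g = g} xy∈
    with xy∈D² , x≢y , x-y≡g ← ∈-filter⁻ (λ p → ¬? (proj₁ p ≟ proj₂ p) ×-dec ((proj₁ p - proj₂ p) ≟ g))
                                         {xs = cartesianProduct D D} xy∈
    with x∈D , y∈D ← ∈-cartesianProduct⁻ D D xy∈D²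
    = x∈D , y∈D , x≢y , x-y≡g

  ∈-differencePairs⁺ : x ∈ D → y ∈ D → x ≢ y → x - y ≡ g → (x , y) ∈ differencePairs D g
  ∈-differencePairs⁺ {g = g} x∈D y∈D x≢y x-y≡g =
    ∈-filter⁺ (λ p → ¬? (proj₁ p ≟ proj₂ p) ×-dec ((proj₁ p - proj₂ p) ≟ g))
              (∈-cartesianProduct⁺ x∈D y∈D) (x≢y , x-y≡g)

  differencePairs-unique : ∀ g → Unique D → Unique (differencePairs D g)
  differencePairs-unique g u = Unique.filter⁺ _ (Unique.cartesianProduct⁺ u u)

  _≟ᵖ_ : DecidableEquality (Carrier × Carrier)
  _≟ᵖ_ = ≡-dec _≟_ _≟_

  diffCount≤diffCount-neg : ∀ g → Unique D → diffCount D g ≤ diffCount D (- g)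
  diffCount≤diffCount-neg {D = D} g u =
    subst (_≤ diffCount D (- g)) (length-map swap (differencePairs D g))
      (⊆⇒length≤ _≟ᵖ_ (Unique.map⁺ swap-injective (differencePairs-unique g u)) swapped⊆)
    where
    swap-injective : ∀ {p q : Carrier × Carrier} → swap p ≡ swap q → p ≡ q
    swap-injective = cong swap
    swapped⊆ : map swap (differencePairs D g) ⊆ differencePairs D (- g)
    swapped⊆ yx∈ with ∈-map⁻ swap yx∈
    ... | (x , y) , xy∈ , refl with ∈-differencePairs⁻ {D = D} {g = g} xy∈
    ... | x∈D , y∈D , x≢y , x-y≡g =
      ∈-differencePairs⁺ y∈D x∈D (x≢y ∘ sym) (trans (sym (RP.⁻¹-anti-homo‿- x y)) (cong -_ x-y≡g))

  diffCount-neg : ∀ g → Unique D → diffCount D g ≡ diffCount D (- g)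
  diffCount-neg {D = D} g u = ≤-antisym (diffCount≤diffCount-neg g u)
    (subst (λ g′ → diffCount D (- g) ≤ diffCount D g′) (RP.-‿involutive g) (diffCount≤diffCount-neg (- g) u))

  familyDiffCount : List (List Carrier) → Carrier → ℕ
  familyDiffCount Ds g = sum (map (λ D → diffCount D g) Ds)

  familyDiffCount-neg : ∀ g → All Unique Ds → familyDiffCount Ds g ≡ familyDiffCount Ds (- g)
  familyDiffCount-neg g []       = refl
  familyDiffCount-neg g (u ∷ us) = cong₂ _+_ (diffCount-neg g u) (familyDiffCount-neg g us)

  NegClosed : List Carrier → Set
  NegClosed D = ∀ {x} → x ∈ D → - x ∈ D

  negSwap : Carrier × Carrier → Carrier × Carrier
  negSwap (x , y) = - y , - x

  negSwap-involutive : ∀ p → negSwap (negSwap p) ≡ p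
  negSwap-involutive (x , y) = cong₂ _,_ (RP.-‿involutive x) (RP.-‿involutive y)

  negSwap-closed : NegClosed D → ∀ {p} → p ∈ differencePairs D g → negSwap p ∈ differencePairs D g
  negSwap-closed {D = D} {g = g} negClosed {x , y} xy∈ with ∈-differencePairs⁻ {D = D} {g = g} xy∈
  ... | x∈D , y∈D , x≢y , x-y≡g = ∈-differencePairs⁺ (negClosed y∈D) (negClosed x∈D)
    (x≢y ∘ sym ∘ RP.-‿injective)
    (trans (trans (cong (- y ⊕_) (RP.-‿involutive x)) (R.+-comm (- y) x)) x-y≡g)

  module _ (two≢0 : two ≢ 0#) (u : Unique D) (negClosed : NegClosed D) where

    private
      negSwap-fixed? : Decidable (λ p → negSwap p ≡ p)
      negSwap-fixed? = Fixed? _≟ᵖ_ negSwap negSwap-involutive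

      fixed-differencePair : (x , y) ∈ differencePairs D (h ⊕ h) → negSwap (x , y) ≡ (x , y) →
                             x ≡ h × y ≡ - h
      fixed-differencePair {x = x} {h = h} xy∈ fixed with ∈-differencePairs⁻ {D = D} {g = h ⊕ h} xy∈
      ... | _ , _ , _ , x-y≡2h =
        let x≡h = x+x-injective two≢0 (trans (cong (x ⊕_) (sym (cong proj₁ fixed))) x-y≡2h)
        in x≡h , trans (sym (cong proj₂ fixed)) (cong -_ x≡h)

      diffCount≡fixed+even : ∀ h → ∃ λ k →
        diffCount D (h ⊕ h) ≡ length (filter negSwap-fixed? (differencePairs D (h ⊕ h))) + 2 * k
      diffCount≡fixed+even h = length≡fixed+even _≟ᵖ_ negSwap negSwap-involutive
        (differencePairs-unique (h ⊕ h) u) (negSwap-closed negClosed)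

    diffCount-double-odd : h ≢ 0# → h ∈ D → Odd (diffCount D (h ⊕ h))
    diffCount-double-odd {h} h≢0 h∈D with k , count ← diffCount≡fixed+even h =
      k , trans count (cong (_+ 2 * k) (length-filter≡1 _≟ᵖ_ negSwap-fixed?
        (differencePairs-unique (h ⊕ h) u) h,-h∈ (cong₂ _,_ (RP.-‿involutive h) refl) only-fixed))
      where
      h,-h∈ : (h , - h) ∈ differencePairs D (h ⊕ h)
      h,-h∈ = ∈-differencePairs⁺ h∈D (negClosed h∈D)
        (λ h≡-h → x+x≢0 two≢0 h≢0 (trans (cong (h ⊕_) h≡-h) (R.-‿inverseʳ h)))
        (cong (h ⊕_) (RP.-‿involutive h))
      only-fixed : ∀ {p} → p ∈ differencePairs D (h ⊕ h) → negSwap p ≡ p → p ≡ (h , - h)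
      only-fixed {_ , _} p∈ fixed with fixed-differencePair p∈ fixed
      ... | refl , refl = refl

    diffCount-double-even : h ∉ D → Even (diffCount D (h ⊕ h))
    diffCount-double-even {h} h∉D with k , count ← diffCount≡fixed+even h =
      k , trans count (cong (λ ps → length ps + 2 * k) (filter-none negSwap-fixed? (All.tabulate no-fixed)))
      where
      no-fixed : ∀ {p} → p ∈ differencePairs D (h ⊕ h) → negSwap p ≢ p
      no-fixed {_ , _} p∈ fixed with refl , _ ← fixed-differencePair p∈ fixed
                                 with x∈D , _ ← ∈-differencePairs⁻ {D = D} {g = h ⊕ h} p∈ = h∉D x∈D

  Disjoint : List Carrier → List Carrier → Set
  Disjoint A B = ∀ x → x ∈ A → x ∉ B

  disjoint⇒∉concat : All (Disjoint D) Ds → h ∈ D → h ∉ concat Ds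
  disjoint⇒∉concat {Ds = Ds} {h} D#Ds h∈D h∈⋃Ds with B , h∈B , B∈Ds ← ∈-concat⁻′ Ds h∈⋃Ds =
    All.lookup D#Ds B∈Ds h h∈D h∈B

  familyDiffCount-double-even : two ≢ 0# → All Unique Ds → All NegClosed Ds → h ∉ concat Ds →
                                Even (familyDiffCount Ds (h ⊕ h))
  familyDiffCount-double-even two≢0 [] [] _ = 0 , refl
  familyDiffCount-double-even {D ∷ Ds} two≢0 (u ∷ us) (nc ∷ ncs) h∉⋃ = even+even
    (diffCount-double-even two≢0 u nc (h∉⋃ ∘ ∈-++⁺ˡ))
    (familyDiffCount-double-even two≢0 us ncs (h∉⋃ ∘ ∈-++⁺ʳ D))

  familyDiffCount-double-odd : two ≢ 0# → All Unique Ds → All NegClosed Ds → AllPairs Disjoint Ds →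
                               h ≢ 0# → h ∈ concat Ds → Odd (familyDiffCount Ds (h ⊕ h))
  familyDiffCount-double-odd {D ∷ Ds} {h} two≢0 (u ∷ us) (nc ∷ ncs) (D#Ds ∷ disjoint) h≢0 h∈⋃
    with ∈-++⁻ D h∈⋃
  ... | inj₁ h∈D = odd+even (diffCount-double-odd two≢0 u nc h≢0 h∈D)
                            (familyDiffCount-double-even two≢0 us ncs (disjoint⇒∉concat D#Ds h∈D))
  ... | inj₂ h∈⋃Ds = even+odd (diffCount-double-even two≢0 u nc (λ h∈D → disjoint⇒∉concat D#Ds h∈D h∈⋃Ds))
                              (familyDiffCount-double-odd two≢0 us ncs disjoint h≢0 h∈⋃Ds)

module PrimitivePowers (F : FiniteField) (α : FiniteField.Carrier F) (α-primitive : FiniteField.Primitive F α)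
                       (N : ℕ) (q≡1+N : FiniteField.order F ≡ suc N) where

  open FiniteField F renaming (_+_ to infixl 6 _⊕_; _*_ to infixl 7 _⊗_)
  open FieldProperties F
  open DifferenceCounts F using (NegClosed)
  open ≡-Reasoning

  α≢0 : α ≢ 0#
  α≢0 = proj₁ α-primitive

  nonzeros : List Carrier
  nonzeros = without _≟_ 0# elements

  nonzeros-unique : Unique nonzeros
  nonzeros-unique = Unique.filter⁺ _ unique

  length-nonzeros : length nonzeros ≡ N
  length-nonzeros = suc-injective (trans (sym (length-without _≟_ unique (complete 0#))) q≡1+N)

  nonzeros-complete : ∀ {x} → x ≢ 0# → x ∈ nonzeros
  nonzeros-complete x≢0 = ∈-without⁺ _≟_ (complete _) x≢0

  0<N : 0 < N
  0<N = subst (0 <_) length-nonzeros (⊆⇒length≤ _≟_ ([] ∷ []) λ { (here refl) → nonzeros-complete 1≢0 })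

  instance
    N-nonZero : NonZero N
    N-nonZero = >-nonZero 0<N

  -- If α ^ d = 1, every nonzero element is among α ^ 0 , … , α ^ (d - 1).
  ^≢1 : ∀ {d} → 0 < d → d < N → α ^ d ≢ 1#
  ^≢1 {d} 0<d d<N αᵈ≡1 = <⇒≱ d<N (subst₂ _≤_ length-nonzeros (trans (length-map _ (upTo d)) (length-upTo d))
    (⊆⇒length≤ _≟_ nonzeros-unique nonzeros⊆powers))
    where
    instance
      d-nonZero : NonZero d
      d-nonZero = >-nonZero 0<d
    nonzeros⊆powers : nonzeros ⊆ map (α ^_) (upTo d)
    nonzeros⊆powers x∈ with k , refl ← proj₂ α-primitive _ (proj₂ (∈-without⁻ _≟_ {xs = elements} x∈)) =
      subst (_∈ map (α ^_) (upTo d)) (sym (^-mod αᵈ≡1 k)) (∈-map⁺ (α ^_) (∈-upTo⁺ (m%n<n k d)))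

  -- Otherwise α ^ 0 , … , α ^ N would be N + 1 distinct nonzero elements.
  ^N≡1 : α ^ N ≡ 1#
  ^N≡1 with (α ^ N) ≟ 1#
  ... | yes αᴺ≡1 = αᴺ≡1
  ... | no  αᴺ≢1 = ⊥-elim (<⇒≱ (n<1+n N) (subst₂ _≤_ (length-applyUpTo (α ^_) (suc N)) length-nonzeros
    (⊆⇒length≤ _≟_ (Unique.applyUpTo⁺₁ (α ^_) (suc N) distinct) powers⊆nonzeros)))
    where
    distinct : ∀ {i j} → i < j → j < suc N → α ^ i ≢ α ^ j
    distinct {i} {j} i<j (s≤s j≤N) αⁱ≡αʲ with m≤n⇒m<n∨m≡n (≤-trans (m∸n≤m j i) j≤N)
    ... | inj₁ j-i<N = ^≢1 (m<n⇒0<n∸m i<j) j-i<N (^-cancel α≢0 (<⇒≤ i<j) αⁱ≡αʲ)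
    ... | inj₂ j-i≡N = αᴺ≢1 (subst (λ n → α ^ n ≡ 1#) j-i≡N (^-cancel α≢0 (<⇒≤ i<j) αⁱ≡αʲ))
    powers⊆nonzeros : applyUpTo (α ^_) (suc N) ⊆ nonzeros
    powers⊆nonzeros x∈ with i , _ , refl ← ∈-applyUpTo⁻ (α ^_) x∈ = nonzeros-complete (^≢0 α≢0 i)

  ^-injective : ∀ {i j} → i < N → j < N → α ^ i ≡ α ^ j → i ≡ j
  ^-injective {i} {j} i<N j<N αⁱ≡αʲ with <-cmp i j
  ... | tri< i<j _ _ = ⊥-elim
    (^≢1 (m<n⇒0<n∸m i<j) (≤-<-trans (m∸n≤m j i) j<N) (^-cancel α≢0 (<⇒≤ i<j) αⁱ≡αʲ))
  ... | tri≈ _ i≡j _ = i≡j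
  ... | tri> _ _ j<i = ⊥-elim
    (^≢1 (m<n⇒0<n∸m j<i) (≤-<-trans (m∸n≤m i j) i<N) (^-cancel α≢0 (<⇒≤ j<i) (sym αⁱ≡αʲ)))

  module _ (t : ℕ) (t+t≡N : t + t ≡ N) where

    private
      0<t : 0 < t
      0<t = n≢0⇒n>0 λ { refl → <-irrefl t+t≡N 0<N }

      t<N : t < N
      t<N = subst (t <_) t+t≡N (m<m+n t 0<t)

    ^-half≡-1 : α ^ t ≡ - 1#
    ^-half≡-1 = x²≡1⇒x≡-1 (trans (sym (^-+ α t t)) (trans (cong (α ^_) t+t≡N) ^N≡1)) (^≢1 0<t t<N)

    -1≢1 : - 1# ≢ 1#
    -1≢1 -1≡1 = ^≢1 0<t t<N (trans ^-half≡-1 -1≡1)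

  ∈cyc⁻ : ∀ {d m i x} → x ∈ cyc α d m i → ∃ λ k → k < m × x ≡ α ^ (i + d * k)
  ∈cyc⁻ x∈ with k , k∈ , refl ← ∈-map⁻ _ x∈ = k , ∈-upTo⁻ k∈ , refl

  module Cyclotomic (d m : ℕ) (d*m≡N : d * m ≡ N) where

    private instance
      d*m-nonZero : NonZero (d * m)
      d*m-nonZero = subst NonZero (sym d*m≡N) N-nonZero
      d-nonZero : NonZero d
      d-nonZero = m*n≢0⇒m≢0 d
      m-nonZero : NonZero m
      m-nonZero = m*n≢0⇒n≢0 d

    ∈cyc⁺ : ∀ i t → α ^ (i + d * t) ∈ cyc α d m i
    ∈cyc⁺ i t = subst (_∈ cyc α d m i) (sym reduce) (∈-map⁺ (λ k → α ^ (i + d * k)) (∈-upTo⁺ (m%n<n t m)))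
      where
      regroup : ∀ i d r q m → i + d * (r + q * m) ≡ (i + d * r) + q * (d * m)
      regroup = solve-∀
      reduce : α ^ (i + d * t) ≡ α ^ (i + d * (t % m))
      reduce = begin
        α ^ (i + d * t)                           ≡⟨ cong (λ n → α ^ (i + d * n)) (m≡m%n+[m/n]*n t m) ⟩
        α ^ (i + d * (t % m + t / m * m))         ≡⟨ cong (α ^_) (regroup i d (t % m) (t / m) m) ⟩
        α ^ (i + d * (t % m) + t / m * (d * m))   ≡⟨ cong (λ n → α ^ (i + d * (t % m) + t / m * n)) d*m≡N ⟩
        α ^ (i + d * (t % m) + t / m * N)         ≡⟨ ^-periodic ^N≡1 (i + d * (t % m)) (t / m) ⟩
        α ^ (i + d * (t % m))                     ∎

    cyc-negClosed : ∀ {s} → α ^ (d * s) ≡ - 1# → ∀ i → NegClosed (cyc α d m i)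
    cyc-negClosed {s} αᵈˢ≡-1 i x∈ with k , _ , refl ← ∈cyc⁻ {d} {m} {i} x∈ =
      subst (_∈ cyc α d m i) shift (∈cyc⁺ i (s + k))
      where
      regroup : ∀ d s i k → d * s + (i + d * k) ≡ i + d * (s + k)
      regroup = solve-∀
      shift : α ^ (i + d * (s + k)) ≡ - (α ^ (i + d * k))
      shift = begin
        α ^ (i + d * (s + k))             ≡⟨ cong (α ^_) (sym (regroup d s i k)) ⟩
        α ^ (d * s + (i + d * k))         ≡⟨ ^-+ α (d * s) _ ⟩
        α ^ (d * s) ⊗ α ^ (i + d * k)     ≡⟨ cong (_⊗ α ^ (i + d * k)) αᵈˢ≡-1 ⟩
        - 1# ⊗ α ^ (i + d * k)            ≡⟨ RP.-1*x≈-x _ ⟩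
        - (α ^ (i + d * k))               ∎

    ∈cyc₀⇒∣ : ∀ {j} → α ^ j ∈ cyc α d m 0 → d ∣ j
    ∈cyc₀⇒∣ {j} αʲ∈ with k , k<m , αʲ≡αᵈᵏ ← ∈cyc⁻ {d} {m} {0} αʲ∈ =
      subst (d ∣_) (sym (m≡m%n+[m/n]*n j N)) (∣m∣n⇒∣m+n d∣j%N (∣-trans d∣N (n∣m*n (j / N))))
      where
      j%N≡dk : j % N ≡ d * k
      j%N≡dk = ^-injective (m%n<n j N) (subst (d * k <_) d*m≡N (*-monoʳ-< d k<m))
                 (trans (sym (^-mod ^N≡1 j)) αʲ≡αᵈᵏ)
      d∣j%N : d ∣ j % N
      d∣j%N = subst (d ∣_) (sym j%N≡dk) (m∣m*n k)
      d∣N : d ∣ N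
      d∣N = subst (d ∣_) d*m≡N (m∣m*n m)

module Corollary (F : FiniteField) (α : FiniteField.Carrier F) (α-primitive : FiniteField.Primitive F α)
                 (N : ℕ) (q≡1+N : FiniteField.order F ≡ suc N)
                 (e f ε ρ Q : ℕ) (1<ε : 1 < ε)
                 (ερ≡N : ε * ρ ≡ N) (ef≡N : e * f ≡ N) (e≡Qε : e ≡ suc Q * ε) where

  open FiniteField F renaming (_+_ to infixl 6 _⊕_; _*_ to infixl 7 _⊗_)
  open FieldProperties F
  open DifferenceCounts F
  open PrimitivePowers F α α-primitive N q≡1+N
  open DecMembership _≟_ using (_∈?_)
  module ε-classes = Cyclotomic ε ρ ερ≡N
  module e-classes = Cyclotomic e f ef≡N

  private variable
    v      : Carrier → ℕ
    T      : List Carrier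
    λ′ μ k : ℕ

  S : List Carrier
  S = cyc α ε ρ 0

  classes : List (List Carrier)
  classes = map (λ j → cyc α e f (j * ε)) (upTo (suc Q))

  1∈S : 1# ∈ S
  1∈S = subst (_∈ S) (cong (α ^_) (*-zeroʳ ε)) (ε-classes.∈cyc⁺ 0 0)

  1∈⋃classes : 1# ∈ concat classes
  1∈⋃classes = ∈-concat⁺′ {xss = classes}
    (subst (_∈ cyc α e f 0) (cong (α ^_) (*-zeroʳ e)) (e-classes.∈cyc⁺ 0 0)) (here refl)

  class⊆S : ∀ j → cyc α e f (j * ε) ⊆ S
  class⊆S j x∈ with k , _ , refl ← ∈cyc⁻ {e} {f} {j * ε} x∈ =
    subst (_∈ S) (cong (α ^_) (sym regroup)) (ε-classes.∈cyc⁺ 0 (j + suc Q * k))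
    where
    regroup′ : ∀ j k Q ε → j * ε + Q * ε * k ≡ ε * (j + Q * k)
    regroup′ = solve-∀
    regroup : j * ε + e * k ≡ ε * (j + suc Q * k)
    regroup = trans (cong (λ n → j * ε + n * k) e≡Qε) (regroup′ j k (suc Q) ε)

  ⋃classes⊆S : concat classes ⊆ S
  ⋃classes⊆S x∈⋃ with D , x∈D , D∈ ← ∈-concat⁻′ classes x∈⋃
                   with j , _ , refl ← ∈-map⁻ (λ j → cyc α e f (j * ε)) {xs = upTo (suc Q)} D∈ =
    class⊆S j x∈D

  classes-negClosed : Even f → All NegClosed classes
  classes-negClosed (s , f≡2s) = All.tabulate λ D∈ → case D∈
    where
    regroup : ∀ e s → e * s + e * s ≡ e * (2 * s)
    regroup = solve-∀
    es+es≡N : e * s + e * s ≡ N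
    es+es≡N = trans (regroup e s) (trans (cong (e *_) (sym f≡2s)) ef≡N)
    case : ∀ {D} → D ∈ classes → NegClosed D
    case D∈ with j , _ , refl ← ∈-map⁻ (λ j → cyc α e f (j * ε)) {xs = upTo (suc Q)} D∈ =
      e-classes.cyc-negClosed (^-half≡-1 (e * s) es+es≡N) (j * ε)

  α⊗x∉S : ∀ {x} → x ∈ S → α ⊗ x ∉ S
  α⊗x∉S x∈S αx∈S with a , _ , refl ← ∈cyc⁻ {ε} {ρ} {0} x∈S =
    <⇒≢ 1<ε (sym (∣1⇒≡1 (∣m+n∣m⇒∣n ε∣εa+1 (m∣m*n a))))
    where
    ε∣εa+1 : ε ∣ ε * a + 1
    ε∣εa+1 = subst (ε ∣_) (+-comm 1 (ε * a)) (ε-classes.∈cyc₀⇒∣ αx∈S)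

  α∉S : α ∉ S
  α∉S α∈S = α⊗x∉S 1∈S (subst (_∈ S) (sym (R.*-identityʳ α)) α∈S)

  α⊗α∉S : 2 < ε → α ⊗ α ∉ S
  α⊗α∉S 2<ε α²∈S =
    <⇒≱ 2<ε (∣⇒≤ (ε-classes.∈cyc₀⇒∣ (subst (_∈ S) (cong (α ⊗_) (sym (R.*-identityʳ α))) α²∈S)))

  -- If α ⊕ α ∈ S then α ⊗ α ⊕ α ⊗ α = α ⊗ (α ⊕ α) ∉ S.
  double-outside-S : 2 < ε → ∃ λ h → h ≢ 0# × h ∉ S × h ⊕ h ∉ S
  double-outside-S 2<ε with (α ⊕ α) ∈? S
  ... | no  2α∉S = α , α≢0 , α∉S , 2α∉S
  ... | yes 2α∈S = α ⊗ α , α⊗α≢0 , α⊗α∉S 2<ε , subst (_∉ S) (R.distribˡ α α α) (α⊗x∉S 2α∈S)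
    where
    α⊗α≢0 : α ⊗ α ≢ 0#
    α⊗α≢0 α²≡0 = α≢0 (*-cancelˡ α≢0 (trans α²≡0 (sym (R.zeroʳ α))))

  module PartA (q≡1+2εk : order ≡ 1 + 2 * ε * k) where

    private
      εk+εk≡N : ε * k + ε * k ≡ N
      εk+εk≡N = trans (double ε k) (suc-injective (trans (sym q≡1+2εk) q≡1+N))
        where
        double : ∀ ε k → ε * k + ε * k ≡ 2 * ε * k
        double = solve-∀

    S-negClosed : NegClosed S
    S-negClosed = ε-classes.cyc-negClosed (^-half≡-1 (ε * k) εk+εk≡N) 0

    two≢0 : two ≢ 0#
    two≢0 = -1≢1⇒two≢0 (-1≢1 (ε * k) εk+εk≡N)

    proper : DiffProfile v T λ′ μ → Odd (v two) → (∀ {h} → h ∉ S → Even (v (h ⊕ h))) → λ′ ≢ μ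
    proper profile odd-at-two even-off-S =
      odd-even⇒proper profile two≢0 (x+x≢0 two≢0 α≢0) odd-at-two (even-off-S α∉S)

    ±two∈S : 2 < ε → DiffProfile v T λ′ μ → T ⊆ S → Odd (v two) → (∀ {h} → h ∉ S → Even (v (h ⊕ h))) →
             minusTwo ∈ S × two ∈ S
    ±two∈S 2<ε profile T⊆S odd-at-two even-off-S = S-negClosed two∈S , two∈S
      where
      two∈S : two ∈ S
      two∈S with two ∈? S | double-outside-S 2<ε
      ... | yes two∈S | _ = two∈S
      ... | no  two∉S | h , h≢0 , h∉S , 2h∉S = ⊥-elim (odd-even-outside⇒⊥ profile two≢0 (x+x≢0 two≢0 h≢0)
            (two∉S ∘ T⊆S) (2h∉S ∘ T⊆S) odd-at-two (even-off-S h∉S))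

    pds-parities : IsPDSWith S λ′ μ →
                   Odd (diffCount S two) × (∀ {h} → h ∉ S → Even (diffCount S (h ⊕ h)))
    pds-parities (subset , _) = diffCount-double-odd two≢0 (proj₂ subset) S-negClosed 1≢0 1∈S
                              , diffCount-double-even two≢0 (proj₂ subset) S-negClosed

    dpdf-parities : Even f → IsDPDFWith classes λ′ μ →
                    Odd (familyDiffCount classes two) × (∀ {h} → h ∉ S → Even (familyDiffCount classes (h ⊕ h)))
    dpdf-parities f-even (subsets , disjoint , _ , _) =
        familyDiffCount-double-odd two≢0 unique′ (classes-negClosed f-even) disjoint 1≢0 1∈⋃classes
      , λ h∉S → familyDiffCount-double-even two≢0 unique′ (classes-negClosed f-even) (h∉S ∘ ⋃classes⊆S)
      where
      unique′ : All Unique classes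
      unique′ = All.map proj₂ subsets

    pds-proper : IsPDSWith S λ′ μ → λ′ ≢ μ
    pds-proper P@(_ , profile) = uncurry (proper profile) (pds-parities P)

    pds-±two∈S : 2 < ε → IsPDSWith S λ′ μ → minusTwo ∈ S × two ∈ S
    pds-±two∈S 2<ε P@(_ , profile) = uncurry (±two∈S 2<ε profile id) (pds-parities P)

    dpdf-proper : Even f → IsDPDFWith classes λ′ μ → λ′ ≢ μ
    dpdf-proper f-even P@(_ , _ , _ , profile) = uncurry (proper profile) (dpdf-parities f-even P)

    dpdf-±two∈S : 2 < ε → Even f → IsDPDFWith classes λ′ μ → minusTwo ∈ S × two ∈ S
    dpdf-±two∈S 2<ε f-even P@(_ , _ , _ , profile) =
      uncurry (±two∈S 2<ε profile ⋃classes⊆S) (dpdf-parities f-even P)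

  module PartB {t} (q≡ε+1+2εk : order ≡ ε + 1 + 2 * ε * k) (ε≡2t : ε ≡ 2 * t) where

    -- - 1 = α ^ (t ρ), and ε = 2 t divides t ρ only if ρ is even; but ρ = 1 + 2 k.
    -1∉S : - 1# ∉ S
    -1∉S -1∈S = odd⇒¬even (k , ρ≡1+2k) (2∣⇒even (*-cancelˡ-∣ t t*2∣t*ρ))
      where
      instance
        t-nonZero : NonZero t
        t-nonZero = >-nonZero (n≢0⇒n>0 λ t≡0 →
          <⇒≱ 1<ε (≤-trans (≤-reflexive (trans ε≡2t (cong (2 *_) t≡0))) z≤n))
        ε-nonZero : NonZero ε
        ε-nonZero = >-nonZero (<-trans (s≤s z≤n) 1<ε)
      regroup : ∀ ε k → ε + 1 + 2 * ε * k ≡ 1 + ε * (1 + 2 * k)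
      regroup = solve-∀
      ρ≡1+2k : ρ ≡ 1 + 2 * k
      ρ≡1+2k = *-cancelˡ-≡ ρ (1 + 2 * k) ε
        (suc-injective (trans (cong suc ερ≡N) (trans (sym q≡1+N) (trans q≡ε+1+2εk (regroup ε k)))))
      double : ∀ t ρ → t * ρ + t * ρ ≡ 2 * t * ρ
      double = solve-∀
      tρ+tρ≡N : t * ρ + t * ρ ≡ N
      tρ+tρ≡N = trans (double t ρ) (trans (cong (_* ρ) (sym ε≡2t)) ερ≡N)
      t*2∣t*ρ : t * 2 ∣ t * ρ
      t*2∣t*ρ = subst (_∣ t * ρ) (trans ε≡2t (*-comm 2 t))
        (ε-classes.∈cyc₀⇒∣ (subst (_∈ S) (sym (^-half≡-1 (t * ρ) tρ+tρ≡N)) -1∈S))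

    improper : DiffProfile v T λ′ μ → T ⊆ S → 1# ∈ T → v 1# ≡ v (- 1#) → λ′ ≡ μ
    improper profile T⊆S 1∈T v-sym = inside-outside⇒improper profile 1≢0 -1≢0 1∈T (-1∉S ∘ T⊆S) v-sym

    pds-improper : IsPDSWith S λ′ μ → λ′ ≡ μ
    pds-improper (subset , profile) = improper profile id 1∈S (diffCount-neg 1# (proj₂ subset))

    dpdf-improper : IsDPDFWith classes λ′ μ → λ′ ≡ μ
    dpdf-improper (subsets , _ , _ , profile) =
      improper profile ⋃classes⊆S 1∈⋃classes (familyDiffCount-neg 1# (All.map proj₂ subsets))

open FiniteField using (Carrier; Primitive; order; cyc; IsPDSWith; IsDPDFWith; two; minusTwo)

corollary3p17 : (F : FiniteField) →
    (α : Carrier F) → Primitive F α →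
    (e f ε ρ : ℕ) → 1 < e → 1 < f → 1 < ε → 1 < ρ →
    order F ≡ e * f + 1 → order F ≡ ε * ρ + 1 → (ε∣e : ε ∣ e) →
    ((∃ λ k → order F ≡ 1 + 2 * ε * k) →
       (∀ λ′ μ → IsPDSWith F (cyc F α ε ρ 0) λ′ μ → λ′ ≢ μ) ×
       (Even f → ∀ λ′ μ → IsDPDFWith F (familyC0′ F α e f ε ε∣e) λ′ μ → λ′ ≢ μ) ×
       (2 < ε → ∀ λ′ μ → IsPDSWith F (cyc F α ε ρ 0) λ′ μ → minusTwo F ∈ (cyc F α ε ρ 0) × two F ∈ (cyc F α ε ρ 0)) ×
       (2 < ε → Even f → ∀ λ′ μ → IsDPDFWith F (familyC0′ F α e f ε ε∣e) λ′ μ → minusTwo F ∈ (cyc F α ε ρ 0) × two F ∈ (cyc F α ε ρ 0))) ×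
    ((∃ λ k → order F ≡ ε + 1 + 2 * ε * k) → Even ε →
       (∀ λ′ μ → IsPDSWith F (cyc F α ε ρ 0) λ′ μ → λ′ ≡ μ) ×
       (ε < e → ∀ λ′ μ → IsDPDFWith F (familyC0′ F α e f ε ε∣e) λ′ μ → λ′ ≡ μ))
corollary3p17 F α α-primitive e f ε ρ 1<e _ _ _ _ _ (divides zero e≡0) =
  ⊥-elim (<⇒≱ 1<e (≤-trans (≤-reflexive e≡0) z≤n))
corollary3p17 F α α-primitive e f ε ρ _ _ 1<ε _ q≡ef+1 q≡ερ+1 (divides (suc Q) e≡Qε) =
  (λ (_ , q≡1+2εk) → let open PartA q≡1+2εk in
      (λ _ _ → pds-proper)
    , (λ f-even _ _ → dpdf-proper f-even)
    , (λ 2<ε _ _ → pds-±two∈S 2<ε)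
    , (λ 2<ε f-even _ _ → dpdf-±two∈S 2<ε f-even)) ,
  (λ (_ , q≡ε+1+2εk) (t , ε≡2t) → let open PartB {t = t} q≡ε+1+2εk ε≡2t in
      (λ _ _ → pds-improper)
    , (λ _ _ _ → dpdf-improper))
  where
  ερ≡ef : ε * ρ ≡ e * f
  ερ≡ef = +-cancelʳ-≡ 1 (ε * ρ) (e * f) (trans (sym q≡ερ+1) q≡ef+1)
  open Corollary F α α-primitive (e * f) (trans q≡ef+1 (+-comm (e * f) 1)) e f ε ρ Q 1<ε ερ≡ef refl e≡Qε
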